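{- Let $T$ be a tree rooted in a vertex $r$, $\tau$ a threshold function for $T$, $u$ a vertex of $T$ that is not a leaf with children $v_1,\ldots,v_k$, and $b$ a non-negative integer. Then $$y_\in(u,b)=\max\Big\{\sum_{i=1}^k\max\{y_\in(v_i,b_i),y_0(v_i,b_i)\}:(b_1,\ldots,b_k)\in\mathcal{P}_k(b-1)\Big\}.$$
   Context: A threshold function for a graph $G$ is a function $\tau:U\to\mathbb{Z}\cup\{\infty\}$ whose domain $U$ contains $V(G)$. For $D\subseteq V(G)$, the hull $H_{(G,\tau)}(D)$ is the smallest $H\subseteq V(G)$ with $D\subseteq H$ and $u\in H$ for every vertex $u$ with $|H\cap N_G(u)|\geq\tau(u)$; $D$ is a dynamic monopoly if $H_{(G,\tau)}(D)=V(G)$; ${\rm dyn}(G,\tau)$ is the minimum order of a dynamic monopoly (0 for the empty graph). $T_u$ is the subtree of $T$ induced by $u$ and its descendants. Define $y_\in(u,b)=\max\{{\rm dyn}(T_u-Y,\tau):Y\subseteq V(T_u),|Y|=b,u\in Y\}$ and $y_0(u,b)=\max\{{\rm dyn}(T_u-Y,\tau):Y\subseteq V(T_u),|Y|=b,u\notin Y\}$, with $\max\emptyset=-\infty$ and sums involving $-\infty$ equal to $-\infty$. $\mathcal{P}_k(b)=\{(b_1,\ldots,b_k)\in\mathbb{N}_0^k:b_1+\cdots+b_k=b\}$ (empty if $b<0$). -}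

module Defs where

open import Data.Bool using (Bool; true; false; _∧_; _∨_; not; if_then_else_)
import Data.Bool
open import Data.Nat as ℕ using (ℕ; zero; suc; _+_; _⊓_; _≡ᵇ_; _≤_)
open import Data.Integer as ℤ using (ℤ; +_; -[1+_])
open import Data.Fin using (Fin; toℕ)
open import Data.Fin.Properties using () renaming (_≟_ to _≟ᶠ_)
open import Data.Vec as Vec using (Vec; []; _∷_; lookup; tabulate)
open import Data.List as List using (List; []; _∷_; concatMap; foldr; allFin)
open import Data.Bool.ListAction using (all; any)
open import Data.Fin.Subset using (Subset; ∣_∣; _∩_; _─_)
open import Relation.Nullary.Decidable using (⌊_⌋)
open import Relation.Binary.PropositionalEquality using (_≡_; _≢_)
open import Data.Product using (_×_; ∃)

_∈ᵇ_ : ∀ {n} → Fin n → Subset n → Bool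
v ∈ᵇ S = lookup S v

_⊆ᵇ_ : ∀ {n} → Subset n → Subset n → Bool
_⊆ᵇ_ {n} A B = all (λ v → not (v ∈ᵇ A) ∨ (v ∈ᵇ B)) (allFin n)

allSubsets : (n : ℕ) → List (Subset n)
allSubsets zero    = [] ∷ []
allSubsets (suc n) = concatMap (λ S → (true ∷ S) ∷ (false ∷ S) ∷ []) (allSubsets n)

data Threshold : Set where
  fin : ℤ → Threshold
  ∞   : Threshold

reaches : ℕ → Threshold → Bool
reaches c (fin t) = t ℤ.≤ᵇ (+ c)
reaches c ∞       = false

-- Graphs on vertex set Fin n, given by an adjacency function.
-- Every graph occurring in the lemma is an induced subgraph G[S]
-- (vertex set S, the edges of G with both ends in S).

Graph : ℕ → Set
Graph n = Fin n → Fin n → Bool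

nbhd : ∀ {n} → Graph n → Subset n → Fin n → Subset n
nbhd G S u = tabulate (λ w → (w ∈ᵇ S) ∧ G u w)

closed : ∀ {n} → Graph n → (Fin n → Threshold) → Subset n → Subset n → Bool
closed {n} G τ S H =
  all (λ u → not ((u ∈ᵇ S) ∧ reaches ∣ H ∩ nbhd G S u ∣ (τ u)) ∨ (u ∈ᵇ H)) (allFin n)

inHull : ∀ {n} → Graph n → (Fin n → Threshold) → Subset n → Subset n → Fin n → Bool
inHull {n} G τ S D v =
  all (λ H → not ((H ⊆ᵇ S) ∧ (D ⊆ᵇ H) ∧ closed G τ S H) ∨ (v ∈ᵇ H)) (allSubsets n)

isDynMono : ∀ {n} → Graph n → (Fin n → Threshold) → Subset n → Subset n → Bool
isDynMono {n} G τ S D =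
  (D ⊆ᵇ S) ∧ all (λ v → not (v ∈ᵇ S) ∨ inHull G τ S D v) (allFin n)

-- dyn(G[S], τ): minimum order of a dynamic monopoly.
-- (S itself is always a dynamic monopoly of order ≤ n, so the initial
-- value n of the fold never survives as a spurious value; for the
-- empty graph D = ∅ gives 0.)
dyn : ∀ {n} → Graph n → (Fin n → Threshold) → Subset n → ℕ
dyn {n} G τ S =
  foldr (λ D acc → if isDynMono G τ S D then ∣ D ∣ ⊓ acc else acc) n (allSubsets n)

data ℕ⁻∞ : Set where
  -∞  : ℕ⁻∞
  val : ℕ → ℕ⁻∞

_⊔⁻_ : ℕ⁻∞ → ℕ⁻∞ → ℕ⁻∞
-∞    ⊔⁻ y     = y
val a ⊔⁻ -∞    = val a
val a ⊔⁻ val b = val (a ℕ.⊔ b)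

_+⁻_ : ℕ⁻∞ → ℕ⁻∞ → ℕ⁻∞
-∞    +⁻ _     = -∞
val a +⁻ -∞    = -∞
val a +⁻ val b = val (a + b)

maxOver : ∀ {A : Set} → List A → (A → ℕ⁻∞) → ℕ⁻∞
maxOver xs f = foldr (λ x acc → f x ⊔⁻ acc) -∞ xs

sum⁻ : ∀ {k} → (Fin k → ℕ⁻∞) → ℕ⁻∞
sum⁻ f = Vec.foldr _ _+⁻_ (val 0) (tabulate f)

compositions : (k : ℕ) → ℕ → List (Vec ℕ k)
compositions zero    zero    = [] ∷ []
compositions zero    (suc b) = []
compositions (suc k) b       =
  concatMap (λ i → List.map (λ bs → i ∷ bs) (compositions k (b ℕ.∸ i)))
            (List.upTo (suc b))

𝒫 : (k : ℕ) → ℤ → List (Vec ℕ k)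
𝒫 k (+ b)     = compositions k b
𝒫 k -[1+ _ ]  = []

-- Rooted trees on Fin n, given by a parent map p with root r:
-- p r = r and every vertex reaches r by iterating p.
-- The tree T has edges {v, p v} for v ≠ r.

iter : ∀ {n} → (Fin n → Fin n) → ℕ → Fin n → Fin n
iter p zero    v = v
iter p (suc j) v = p (iter p j v)

IsRootedTree : ∀ {n} → (Fin n → Fin n) → Fin n → Set
IsRootedTree {n} p r = (p r ≡ r) × (∀ v → ∃ λ j → iter p j v ≡ r)

_==_ : ∀ {n} → Fin n → Fin n → Bool
x == y = ⌊ x ≟ᶠ y ⌋

treeGraph : ∀ {n} → (Fin n → Fin n) → Fin n → Graph n
treeGraph p r x y = (not (x == r) ∧ (p x == y)) ∨ (not (y == r) ∧ (p y == x))

IsChild : ∀ {n} → (Fin n → Fin n) → Fin n → Fin n → Fin n → Set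
IsChild p r v u = (v ≢ r) × (p v ≡ u)

-- V(T_u): u and its descendants, i.e. the v with p^j v = u for some j
-- (j < n suffices, since the path from v to the root has < n edges)
subtree : ∀ {n} → (Fin n → Fin n) → Fin n → Subset n
subtree {n} p u = tabulate (λ v → any (λ (j : Fin n) → iter p (toℕ j) v == u) (allFin n))

yMax : ∀ {n} → (Fin n → Fin n) → Fin n → (Fin n → Threshold)
       → Bool → Fin n → ℕ → ℕ⁻∞
yMax {n} p r τ inY u b =
  maxOver (allSubsets n) λ Y →
    if (Y ⊆ᵇ subtree p u) ∧ (∣ Y ∣ ≡ᵇ b) ∧ ⌊ Data.Bool._≟_ (u ∈ᵇ Y) inY ⌋
    then val (dyn (treeGraph p r) τ (subtree p u ─ Y))
    else -∞

y∈ : ∀ {n} → (Fin n → Fin n) → Fin n → (Fin n → Threshold) → Fin n → ℕ → ℕ⁻∞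
y∈ p r τ = yMax p r τ true

y₀ : ∀ {n} → (Fin n → Fin n) → Fin n → (Fin n → Threshold) → Fin n → ℕ → ℕ⁻∞
y₀ p r τ = yMax p r τ false

module Submission where

-- Write Tᵥ i for the subtree of the i-th child vᵢ of u. If u ∈ Y ⊆ T_u, then T_u − Y is the disjoint
-- union of the sets Tᵥ i − Yᵢ with Yᵢ = Y ∩ Tᵥ i, and no edge of T joins two of them. The hull process
-- never crosses between such components, so dyn is additive over them:
-- dyn(T_u − Y) = Σ dyn(Tᵥ i − Yᵢ), where Σ |Yᵢ| = |Y| − 1. Conversely any Yᵢ ⊆ Tᵥ i reassemble into
-- Y = {u} ∪ ⋃ Yᵢ. So maximising over Y is maximising independently over each Yᵢ of prescribed size bᵢ,
-- with vᵢ ∈ Yᵢ or not, which is max{y∈(vᵢ,bᵢ), y₀(vᵢ,bᵢ)}.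

open import Defs
open import Data.Bool using (Bool; true; false; T; not; _∧_; _∨_; if_then_else_)
import Data.Bool
open import Data.Bool.Properties using (T-∧; T-∨; T-≡)
open import Data.Fin using (Fin; zero; suc; toℕ; fromℕ<)
open import Data.Fin.Properties using (pigeonhole; toℕ<n; toℕ-fromℕ<; suc-injective) renaming (_≟_ to _≟ᶠ_)
open import Data.Fin.Subset using (Subset; _∈_; _∉_; _⊆_; _∩_; _∪_; _─_; ⁅_⁆; ⊥; ∣_∣; ⋃; inside; outside)
open import Data.Fin.Subset.Properties
  using (∉⊥; ∣⊥∣≡0; ∣p∣≤n; ∣⁅x⁆∣≡1; x∈⁅x⁆; x∈⁅y⁆⇒x≡y; ⊆-antisym;
         x∈p∪q⁺; x∈p∪q⁻; x∈p∩q⁺; x∈p∩q⁻; p∩q⊆q; p─q⊆p; x∈p∧x∉q⇒x∈p─q; ∪-comm)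
open import Data.List as List using (List; []; _∷_; foldr; allFin)
open import Data.List.Membership.Propositional using (find; lose) renaming (_∈_ to _∈ˡ_)
open import Data.List.Membership.Propositional.Properties
  using (∈-allFin; ∈-concatMap⁺; ∈-concatMap⁻; ∈-map⁺; ∈-map⁻; ∈-upTo⁺; ∈-upTo⁻)
open import Data.List.Relation.Unary.Any as Any using (here; there)
open import Data.List.Relation.Unary.Any.Properties using (any⇔)
import Data.List.Relation.Unary.All as All
open import Data.List.Relation.Unary.All.Properties using (all⁺; all⁻)
open import Data.Bool.ListAction using (all; any)
open import Data.Nat as ℕ using (ℕ; zero; suc; _+_; _*_; _∸_; _⊓_; _≤_; _<_; _≥_; _≡ᵇ_)
open import Data.Nat.Induction using (<-wellFounded)
open import Induction.WellFounded using (Acc; acc)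
open import Data.Nat.Properties as ℕ
  using (≤-refl; ≤-trans; ≤-antisym; m⊓n≤m; m⊓n≤n; ⊓-sel; ≡ᵇ⇒≡; ≡⇒≡ᵇ)
open import Data.Integer using (+_; _-_)
open import Data.Product using (_×_; _,_; proj₁; proj₂; ∃-syntax; Σ-syntax)
open import Data.Sum as Sum using (_⊎_; inj₁; inj₂; [_,_]′)
open import Data.Vec as Vec using (Vec; []; _∷_; lookup; tabulate; here; there)
open import Data.Vec.Functional using () renaming (_∷_ to _∷ᶠ_)
open import Data.Vec.Properties using (lookup∘tabulate; tabulate∘lookup; tabulate-cong; []=⇒lookup; lookup⇒[]=)
open import Data.Vec.Membership.Propositional using () renaming (_∈_ to _∈ᵛ_)
open import Data.Vec.Membership.Propositional.Properties using (∈-lookup)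
open import Data.Vec.Relation.Unary.Any using (index)
open import Data.Vec.Relation.Unary.Any.Properties using (lookup-index)
open import Data.Vec.Relation.Unary.Unique.Propositional using (Unique)
open import Data.Vec.Relation.Unary.Unique.Propositional.Properties using (lookup-injective)
open import Function using (_∘_; _⇔_; mk⇔; Equivalence)
open import Relation.Binary.Bundles using (Preorder)
import Relation.Binary.Reasoning.Preorder
open import Relation.Binary.PropositionalEquality
open import Relation.Nullary using (¬_; yes; no; contradiction)
open import Relation.Nullary.Decidable using (⌊_⌋; toWitness; fromWitness)

open Equivalence using (to; from)

private
  variable
    n k : ℕ

T-not-∨ : ∀ {a b} → T (not a ∨ b) ⇔ (T a → T b)
T-not-∨ {true}  = mk⇔ (λ tb _ → tb) (λ f → f _)
T-not-∨ {false} = mk⇔ (λ _ ()) (λ _ → _)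

T-all-⇒ : ∀ {A : Set} (a b : A → Bool) {xs : List A} → (∀ x → x ∈ˡ xs) →
          T (all (λ x → not (a x) ∨ b x) xs) ⇔ (∀ x → T (a x) → T (b x))
T-all-⇒ a b {xs} complete =
  mk⇔ (λ t x → to T-not-∨ (All.lookup (all⁺ f xs t) (complete x)))
      (λ h → all⁻ f {xs = xs} (All.tabulate (λ {x} _ → from T-not-∨ (h x))))
  where f = λ x → not (a x) ∨ b x

∈-allSubsets : (S : Subset n) → S ∈ˡ allSubsets n
∈-allSubsets []          = here refl
∈-allSubsets (true  ∷ S) = ∈-concatMap⁺ _ (Any.map (λ { refl → here refl }) (∈-allSubsets S))
∈-allSubsets (false ∷ S) = ∈-concatMap⁺ _ (Any.map (λ { refl → there (here refl) }) (∈-allSubsets S))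

T-∈ᵇ : ∀ {v : Fin n} {S} → T (v ∈ᵇ S) ⇔ v ∈ S
T-∈ᵇ = mk⇔ (λ t → lookup⇒[]= _ _ (to T-≡ t)) (λ v∈S → from T-≡ ([]=⇒lookup v∈S))

T-⊆ᵇ : ∀ (A B : Subset n) → T (A ⊆ᵇ B) ⇔ A ⊆ B
T-⊆ᵇ A B =
  mk⇔ (λ t {v} v∈A → to T-∈ᵇ (to all⇔ t v (from T-∈ᵇ v∈A)))
      (λ A⊆B → from all⇔ λ v t → from T-∈ᵇ (A⊆B (to T-∈ᵇ t)))
  where all⇔ = T-all-⇒ (_∈ᵇ A) (_∈ᵇ B) ∈-allFin

module _ {A : Set} (P : A → Bool) (c : A → ℕ) (e : ℕ) where

  minWhere : List A → ℕ
  minWhere = foldr (λ x acc → if P x then c x ⊓ acc else acc) e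

  minWhere-≤ : ∀ {x xs} → x ∈ˡ xs → T (P x) → minWhere xs ≤ c x
  minWhere-≤ {xs = y ∷ ys} (here refl) Py with P y
  ... | true  = m⊓n≤m (c y) (minWhere ys)
  minWhere-≤ {xs = y ∷ ys} (there x∈ys) Px with P y
  ... | true  = ≤-trans (m⊓n≤n (c y) (minWhere ys)) (minWhere-≤ x∈ys Px)
  ... | false = minWhere-≤ x∈ys Px

  minWhere-attained : ∀ xs → minWhere xs ≡ e ⊎ ∃[ x ] T (P x) × minWhere xs ≡ c x
  minWhere-attained []       = inj₁ refl
  minWhere-attained (y ∷ ys) with P y in Py
  ... | false = minWhere-attained ys
  ... | true with ⊓-sel (c y) (minWhere ys)
  ...   | inj₁ min≡cy = inj₂ (y , from T-≡ Py , min≡cy)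
  ...   | inj₂ min≡rest rewrite min≡rest = minWhere-attained ys

module _ (G : Graph n) (τ : Fin n → Threshold) where

  Closed : Subset n → Subset n → Set
  Closed S H = ∀ {u} → u ∈ S → T (reaches ∣ H ∩ nbhd G S u ∣ (τ u)) → u ∈ H

  IsDynMono : Subset n → Subset n → Set
  IsDynMono S D = D ⊆ S × (∀ {H} → H ⊆ S → D ⊆ H → Closed S H → S ⊆ H)

  T-closed : ∀ {S H} → T (closed G τ S H) ⇔ Closed S H
  T-closed {S} {H} =
    mk⇔ (λ t {u} u∈S r → to T-∈ᵇ (to all⇔ t u (from T-∧ (from T-∈ᵇ u∈S , r))))
        (λ cl → from all⇔ λ u t → let (u∈S , r) = to T-∧ t in from T-∈ᵇ (cl (to T-∈ᵇ u∈S) r))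
    where all⇔ = T-all-⇒ (λ u → (u ∈ᵇ S) ∧ reaches ∣ H ∩ nbhd G S u ∣ (τ u)) (_∈ᵇ H) ∈-allFin

  T-inHull : ∀ {S D v} → T (inHull G τ S D v) ⇔ (∀ {H} → H ⊆ S → D ⊆ H → Closed S H → v ∈ H)
  T-inHull {S} {D} {v} = mk⇔ inHull⇒ inHull⇐
    where
    all⇔ = T-all-⇒ (λ H → (H ⊆ᵇ S) ∧ (D ⊆ᵇ H) ∧ closed G τ S H) (v ∈ᵇ_) ∈-allSubsets

    inHull⇒ : T (inHull G τ S D v) → ∀ {H} → H ⊆ S → D ⊆ H → Closed S H → v ∈ H
    inHull⇒ t {H} H⊆S D⊆H cl =
      to T-∈ᵇ (to all⇔ t H (from T-∧ (from (T-⊆ᵇ H S) H⊆S , from T-∧ (from (T-⊆ᵇ D H) D⊆H , from T-closed cl))))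

    inHull⇐ : (∀ {H} → H ⊆ S → D ⊆ H → Closed S H → v ∈ H) → T (inHull G τ S D v)
    inHull⇐ hull = from all⇔ λ H t →
      let (H⊆S , t′) = to T-∧ t ; (D⊆H , cl) = to T-∧ t′ in
      from T-∈ᵇ (hull (to (T-⊆ᵇ H S) H⊆S) (to (T-⊆ᵇ D H) D⊆H) (to T-closed cl))

  T-isDynMono : ∀ {S D} → T (isDynMono G τ S D) ⇔ IsDynMono S D
  T-isDynMono {S} {D} = mk⇔ isDynMono⇒ isDynMono⇐
    where
    all⇔ = T-all-⇒ (_∈ᵇ S) (inHull G τ S D) ∈-allFin

    isDynMono⇒ : T (isDynMono G τ S D) → IsDynMono S D
    isDynMono⇒ t = to (T-⊆ᵇ D S) D⊆S , λ H⊆S D⊆H cl {v} v∈S →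
                     to T-inHull (to all⇔ hull v (from T-∈ᵇ v∈S)) H⊆S D⊆H cl
      where D⊆S = proj₁ (to T-∧ t) ; hull = proj₂ (to T-∧ t)

    isDynMono⇐ : IsDynMono S D → T (isDynMono G τ S D)
    isDynMono⇐ (D⊆S , hull) = from T-∧ (from (T-⊆ᵇ D S) D⊆S ,
      from all⇔ λ v v∈S → from T-inHull λ H⊆S D⊆H cl → hull H⊆S D⊆H cl (to T-∈ᵇ v∈S))

  IsDynMono-refl : ∀ S → IsDynMono S S
  IsDynMono-refl _ = (λ x∈S → x∈S) , λ _ S⊆H _ → S⊆H

  dyn-≤ : ∀ {S D} → IsDynMono S D → dyn G τ S ≤ ∣ D ∣
  dyn-≤ {S} {D} dm = minWhere-≤ (isDynMono G τ S) ∣_∣ n (∈-allSubsets D) (from T-isDynMono dm)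

  dyn-attained : ∀ S → ∃[ D ] IsDynMono S D × dyn G τ S ≡ ∣ D ∣
  dyn-attained S with minWhere-attained (isDynMono G τ S) ∣_∣ n (allSubsets n)
  ... | inj₂ (D , dm , eq) = D , to T-isDynMono dm , eq
  -- If no dynamic monopoly undercuts the fold's start value n, then S itself (|S| ≤ n) attains it.
  ... | inj₁ eq = S , IsDynMono-refl S ,
                  ≤-antisym (dyn-≤ (IsDynMono-refl S)) (subst (∣ S ∣ ≤_) (sym eq) (∣p∣≤n S))

  dyn-⊥ : dyn G τ ⊥ ≡ 0
  dyn-⊥ = ℕ.n≤0⇒n≡0 (subst (dyn G τ ⊥ ≤_) (∣⊥∣≡0 n) (dyn-≤ (IsDynMono-refl ⊥)))

-- Additivity of dyn

Disjoint : Subset n → Subset n → Set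
Disjoint A B = ∀ {x} → x ∈ A → x ∉ B

Disjoint-sym : ∀ {A B : Subset n} → Disjoint A B → Disjoint B A
Disjoint-sym A∩B=∅ x∈B x∈A = A∩B=∅ x∈A x∈B

NoEdges : Graph n → Subset n → Subset n → Set
NoEdges G A B = ∀ {a b} → a ∈ A → b ∈ B → ¬ T (G a b)

∩-agree : ∀ {X Y N : Subset n} → (∀ {x} → x ∈ N → x ∈ X ⇔ x ∈ Y) → X ∩ N ≡ Y ∩ N
∩-agree {X = X} {Y} {N} agree = ⊆-antisym
  (λ x∈ → let (x∈X , x∈N) = x∈p∩q⁻ X N x∈ in x∈p∩q⁺ (to (agree x∈N) x∈X , x∈N))
  (λ x∈ → let (x∈Y , x∈N) = x∈p∩q⁻ Y N x∈ in x∈p∩q⁺ (from (agree x∈N) x∈Y , x∈N))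

x∈p─q⇒x∉q : ∀ (A B : Subset n) {x} → x ∈ A ─ B → x ∉ B
x∈p─q⇒x∉q (_ ∷ A) (_      ∷ B) (there x∈A─B) (there x∈B) = x∈p─q⇒x∉q A B x∈A─B x∈B
x∈p─q⇒x∉q (_ ∷ A) (inside ∷ B) ()            here

Disjoint-∷⁻ : ∀ {s t} {A B : Subset n} → Disjoint (s ∷ A) (t ∷ B) → Disjoint A B
Disjoint-∷⁻ A∩B=∅ x∈A x∈B = A∩B=∅ (there x∈A) (there x∈B)

∣∪∣-disjoint : ∀ (A B : Subset n) → Disjoint A B → ∣ A ∪ B ∣ ≡ ∣ A ∣ + ∣ B ∣
∣∪∣-disjoint []            []            _     = refl
∣∪∣-disjoint (inside  ∷ A) (inside  ∷ B) A∩B=∅ = contradiction here (A∩B=∅ here)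
∣∪∣-disjoint (inside  ∷ A) (outside ∷ B) A∩B=∅ = cong suc (∣∪∣-disjoint A B (Disjoint-∷⁻ A∩B=∅))
∣∪∣-disjoint (outside ∷ A) (inside  ∷ B) A∩B=∅ =
  trans (cong suc (∣∪∣-disjoint A B (Disjoint-∷⁻ A∩B=∅))) (sym (ℕ.+-suc ∣ A ∣ ∣ B ∣))
∣∪∣-disjoint (outside ∷ A) (outside ∷ B) A∩B=∅ = ∣∪∣-disjoint A B (Disjoint-∷⁻ A∩B=∅)

∣∩∣-split : ∀ {A B D : Subset n} → Disjoint A B → D ⊆ A ∪ B → ∣ D ∣ ≡ ∣ D ∩ A ∣ + ∣ D ∩ B ∣
∣∩∣-split {A = A} {B} {D} A∩B=∅ D⊆A∪B = begin
  ∣ D ∣                   ≡⟨ cong ∣_∣ D≡ ⟩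
  ∣ (D ∩ A) ∪ (D ∩ B) ∣   ≡⟨ ∣∪∣-disjoint (D ∩ A) (D ∩ B) (λ x∈D∩A x∈D∩B →
                               A∩B=∅ (proj₂ (x∈p∩q⁻ D A x∈D∩A)) (proj₂ (x∈p∩q⁻ D B x∈D∩B))) ⟩
  ∣ D ∩ A ∣ + ∣ D ∩ B ∣   ∎
  where
  open ≡-Reasoning
  D≡ : D ≡ (D ∩ A) ∪ (D ∩ B)
  D≡ = ⊆-antisym
    (λ x∈D → x∈p∪q⁺ ([ (λ x∈A → inj₁ (x∈p∩q⁺ (x∈D , x∈A))) , (λ x∈B → inj₂ (x∈p∩q⁺ (x∈D , x∈B))) ]′
                      (x∈p∪q⁻ A B (D⊆A∪B x∈D))))
    (λ x∈ → [ proj₁ ∘ x∈p∩q⁻ D A , proj₁ ∘ x∈p∩q⁻ D B ]′ (x∈p∪q⁻ (D ∩ A) (D ∩ B) x∈))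

module _ (G : Graph n) (τ : Fin n → Threshold) where

  ∈-nbhd : ∀ S u {w} → w ∈ nbhd G S u ⇔ (w ∈ S × T (G u w))
  ∈-nbhd S u {w} = mk⇔
    (λ w∈N → let (w∈S , uw) = to T-∧ (subst T (lookup∘tabulate _ w) (from T-∈ᵇ w∈N)) in to T-∈ᵇ w∈S , uw)
    (λ (w∈S , uw) → to T-∈ᵇ (subst T (sym (lookup∘tabulate _ w)) (from T-∧ (from T-∈ᵇ w∈S , uw))))

  nbhd-∪ : ∀ {A B u} → NoEdges G A B → u ∈ A → nbhd G (A ∪ B) u ≡ nbhd G A u
  nbhd-∪ {A} {B} {u} noEdges u∈A = ⊆-antisym
    (λ w∈N → let (w∈A∪B , uw) = to (∈-nbhd (A ∪ B) u) w∈N in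
      from (∈-nbhd A u) ([ (λ w∈A → w∈A) , (λ w∈B → contradiction uw (noEdges u∈A w∈B)) ]′ (x∈p∪q⁻ A B w∈A∪B) , uw))
    (λ w∈N → let (w∈A , uw) = to (∈-nbhd A u) w∈N in from (∈-nbhd (A ∪ B) u) (x∈p∪q⁺ (inj₁ w∈A) , uw))

  closed-∩ : ∀ {A B H} → NoEdges G A B → Closed G τ (A ∪ B) H → Closed G τ A (H ∩ A)
  closed-∩ {A} {B} {H} noEdges closedH {u} u∈A reached =
    x∈p∩q⁺ (closedH (x∈p∪q⁺ (inj₁ u∈A)) (subst (λ X → T (reaches ∣ X ∣ (τ u))) same reached) , u∈A)
    where
    same : (H ∩ A) ∩ nbhd G A u ≡ H ∩ nbhd G (A ∪ B) u
    same = trans (∩-agree agree) (cong (H ∩_) (sym (nbhd-∪ noEdges u∈A)))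
      where
      agree : ∀ {w} → w ∈ nbhd G A u → w ∈ H ∩ A ⇔ w ∈ H
      agree w∈N = mk⇔ (proj₁ ∘ x∈p∩q⁻ H A) (λ w∈H → x∈p∩q⁺ (w∈H , proj₁ (to (∈-nbhd A u) w∈N)))

  closed-∪ : ∀ {A B H} → Disjoint A B → NoEdges G A B → Closed G τ A H → Closed G τ (A ∪ B) (H ∪ B)
  closed-∪ {A} {B} {H} A∩B=∅ noEdges closedH {u} u∈A∪B reached with x∈p∪q⁻ A B u∈A∪B
  ... | inj₂ u∈B = x∈p∪q⁺ (inj₂ u∈B)
  ... | inj₁ u∈A = x∈p∪q⁺ (inj₁ (closedH u∈A (subst (λ X → T (reaches ∣ X ∣ (τ u))) same reached)))
    where
    same : (H ∪ B) ∩ nbhd G (A ∪ B) u ≡ H ∩ nbhd G A u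
    same = trans (cong ((H ∪ B) ∩_) (nbhd-∪ noEdges u∈A)) (∩-agree agree)
      where
      agree : ∀ {w} → w ∈ nbhd G A u → w ∈ H ∪ B ⇔ w ∈ H
      agree w∈N = mk⇔ ([ (λ w∈H → w∈H) , (λ w∈B → contradiction w∈B (A∩B=∅ (proj₁ (to (∈-nbhd A u) w∈N)))) ]′
                        ∘ x∈p∪q⁻ H B)
                      (x∈p∪q⁺ ∘ inj₁)

  IsDynMono-∩ : ∀ {A B D} → Disjoint A B → NoEdges G A B →
                IsDynMono G τ (A ∪ B) D → IsDynMono G τ A (D ∩ A)
  IsDynMono-∩ {A} {B} {D} A∩B=∅ noEdges (D⊆A∪B , hull) = proj₂ ∘ x∈p∩q⁻ D A , hullA
    where
    hullA : ∀ {H} → H ⊆ A → D ∩ A ⊆ H → Closed G τ A H → A ⊆ H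
    hullA {H} H⊆A D∩A⊆H closedH {v} v∈A =
      [ (λ v∈H → v∈H) , (λ v∈B → contradiction v∈B (A∩B=∅ v∈A)) ]′
        (x∈p∪q⁻ H B (hull H∪B⊆A∪B D⊆H∪B (closed-∪ A∩B=∅ noEdges closedH) (x∈p∪q⁺ (inj₁ v∈A))))
      where
      H∪B⊆A∪B : H ∪ B ⊆ A ∪ B
      H∪B⊆A∪B = x∈p∪q⁺ ∘ [ inj₁ ∘ H⊆A , inj₂ ]′ ∘ x∈p∪q⁻ H B
      D⊆H∪B : D ⊆ H ∪ B
      D⊆H∪B x∈D = x∈p∪q⁺ ([ (λ x∈A → inj₁ (D∩A⊆H (x∈p∩q⁺ (x∈D , x∈A)))) , inj₂ ]′ (x∈p∪q⁻ A B (D⊆A∪B x∈D)))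

  IsDynMono-∪ : ∀ {A B DA DB} → NoEdges G A B → NoEdges G B A →
                IsDynMono G τ A DA → IsDynMono G τ B DB → IsDynMono G τ (A ∪ B) (DA ∪ DB)
  IsDynMono-∪ {A} {B} {DA} {DB} noEdgesAB noEdgesBA (DA⊆A , hullA) (DB⊆B , hullB) =
    x∈p∪q⁺ ∘ [ inj₁ ∘ DA⊆A , inj₂ ∘ DB⊆B ]′ ∘ x∈p∪q⁻ DA DB , hull
    where
    hull : ∀ {H} → H ⊆ A ∪ B → DA ∪ DB ⊆ H → Closed G τ (A ∪ B) H → A ∪ B ⊆ H
    hull {H} _ D⊆H closedH {v} v∈A∪B with x∈p∪q⁻ A B v∈A∪B
    ... | inj₁ v∈A = proj₁ (x∈p∩q⁻ H A (hullA (p∩q⊆q H A)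
                       (λ x∈DA → x∈p∩q⁺ (D⊆H (x∈p∪q⁺ (inj₁ x∈DA)) , DA⊆A x∈DA))
                       (closed-∩ noEdgesAB closedH) v∈A))
    ... | inj₂ v∈B = proj₁ (x∈p∩q⁻ H B (hullB (p∩q⊆q H B)
                       (λ x∈DB → x∈p∩q⁺ (D⊆H (x∈p∪q⁺ (inj₂ x∈DB)) , DB⊆B x∈DB))
                       (closed-∩ noEdgesBA (subst (λ S → Closed G τ S H) (∪-comm A B) closedH)) v∈B))

  dyn-∪ : ∀ {A B} → Disjoint A B → NoEdges G A B → NoEdges G B A →
          dyn G τ (A ∪ B) ≡ dyn G τ A + dyn G τ B
  dyn-∪ {A} {B} A∩B=∅ noEdgesAB noEdgesBA
    with dyn-attained G τ A | dyn-attained G τ B | dyn-attained G τ (A ∪ B)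
  ... | DA , dmA , dynA≡ | DB , dmB , dynB≡ | D , dm , dynA∪B≡ = ≤-antisym ≤-sum sum-≤
    where
    open ℕ.≤-Reasoning
    ≤-sum : dyn G τ (A ∪ B) ≤ dyn G τ A + dyn G τ B
    ≤-sum = begin
      dyn G τ (A ∪ B)       ≤⟨ dyn-≤ G τ (IsDynMono-∪ noEdgesAB noEdgesBA dmA dmB) ⟩
      ∣ DA ∪ DB ∣           ≡⟨ ∣∪∣-disjoint DA DB (λ x∈DA x∈DB → A∩B=∅ (proj₁ dmA x∈DA) (proj₁ dmB x∈DB)) ⟩
      ∣ DA ∣ + ∣ DB ∣       ≡⟨ cong₂ _+_ dynA≡ dynB≡ ⟨
      dyn G τ A + dyn G τ B ∎
    sum-≤ : dyn G τ A + dyn G τ B ≤ dyn G τ (A ∪ B)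
    sum-≤ = begin
      dyn G τ A + dyn G τ B ≤⟨ ℕ.+-mono-≤ (dyn-≤ G τ (IsDynMono-∩ A∩B=∅ noEdgesAB dm))
                                          (dyn-≤ G τ (IsDynMono-∩ (Disjoint-sym A∩B=∅) noEdgesBA
                                                       (subst (λ S → IsDynMono G τ S D) (∪-comm A B) dm))) ⟩
      ∣ D ∩ A ∣ + ∣ D ∩ B ∣ ≡⟨ ∣∩∣-split A∩B=∅ (proj₁ dm) ⟨
      ∣ D ∣                 ≡⟨ dynA∪B≡ ⟨
      dyn G τ (A ∪ B)       ∎

⋃ᶠ : (Fin k → Subset n) → Subset n
⋃ᶠ S = ⋃ (List.tabulate S)

∈-⋃ᶠ : ∀ (S : Fin k → Subset n) {x} → x ∈ ⋃ᶠ S ⇔ (∃[ i ] x ∈ S i)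
∈-⋃ᶠ _ = mk⇔ ∈-⋃ᶠ⁻ ∈-⋃ᶠ⁺
  where
  ∈-⋃ᶠ⁻ : ∀ {k} {S : Fin k → Subset n} {x} → x ∈ ⋃ᶠ S → ∃[ i ] x ∈ S i
  ∈-⋃ᶠ⁻ {k = zero}              x∈⊥ = contradiction x∈⊥ ∉⊥
  ∈-⋃ᶠ⁻ {k = suc k} {S = S} {x} x∈ with x∈p∪q⁻ (S zero) (⋃ᶠ (S ∘ suc)) x∈
  ... | inj₁ x∈S₀ = zero , x∈S₀
  ... | inj₂ x∈⋃  = let (i , x∈Sᵢ) = ∈-⋃ᶠ⁻ {S = S ∘ suc} x∈⋃ in suc i , x∈Sᵢ

  ∈-⋃ᶠ⁺ : ∀ {k} {S : Fin k → Subset n} {x} → ∃[ i ] x ∈ S i → x ∈ ⋃ᶠ S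
  ∈-⋃ᶠ⁺ (zero  , x∈S₀) = x∈p∪q⁺ (inj₁ x∈S₀)
  ∈-⋃ᶠ⁺ (suc i , x∈Sᵢ) = x∈p∪q⁺ (inj₂ (∈-⋃ᶠ⁺ (i , x∈Sᵢ)))

Pairwise : (Subset n → Subset n → Set) → (Fin k → Subset n) → Set
Pairwise R S = ∀ {i j} → i ≢ j → R (S i) (S j)

Pairwise-tail : ∀ R (S : Fin (suc k) → Subset n) → Pairwise R S → Pairwise R (S ∘ suc)
Pairwise-tail _ _ pairwise i≢j = pairwise (i≢j ∘ suc-injective)

Disjoint-⋃ᶠ : ∀ (S : Fin (suc k) → Subset n) → Pairwise Disjoint S → Disjoint (S zero) (⋃ᶠ (S ∘ suc))
Disjoint-⋃ᶠ S disjoint x∈S₀ x∈⋃ = let (i , x∈Sᵢ) = to (∈-⋃ᶠ (S ∘ suc)) x∈⋃ in disjoint (λ ()) x∈S₀ x∈Sᵢ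

∣⋃ᶠ∣ : ∀ (S : Fin k → Subset n) → Pairwise Disjoint S → ∣ ⋃ᶠ S ∣ ≡ Vec.sum (tabulate (∣_∣ ∘ S))
∣⋃ᶠ∣ {k = zero}  {n} S _        = ∣⊥∣≡0 n
∣⋃ᶠ∣ {k = suc k}     S disjoint = trans (∣∪∣-disjoint (S zero) (⋃ᶠ (S ∘ suc)) (Disjoint-⋃ᶠ S disjoint))
                                    (cong (_+_ ∣ S zero ∣) (∣⋃ᶠ∣ (S ∘ suc) (Pairwise-tail Disjoint S disjoint)))

dyn-⋃ᶠ : ∀ (G : Graph n) τ (S : Fin k → Subset n) → Pairwise Disjoint S → Pairwise (NoEdges G) S →
         dyn G τ (⋃ᶠ S) ≡ Vec.sum (tabulate (dyn G τ ∘ S))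
dyn-⋃ᶠ {k = zero}  G τ S _        _       = dyn-⊥ G τ
dyn-⋃ᶠ {k = suc k} G τ S disjoint noEdges =
  trans (dyn-∪ G τ (Disjoint-⋃ᶠ S disjoint) head-to-tail tail-to-head)
        (cong (_+_ (dyn G τ (S zero)))
              (dyn-⋃ᶠ G τ (S ∘ suc) (Pairwise-tail Disjoint S disjoint) (Pairwise-tail (NoEdges G) S noEdges)))
  where
  head-to-tail : NoEdges G (S zero) (⋃ᶠ (S ∘ suc))
  head-to-tail a∈S₀ b∈⋃ = let (i , b∈Sᵢ) = to (∈-⋃ᶠ (S ∘ suc)) b∈⋃ in noEdges (λ ()) a∈S₀ b∈Sᵢ
  tail-to-head : NoEdges G (⋃ᶠ (S ∘ suc)) (S zero)
  tail-to-head a∈⋃ b∈S₀ = let (i , a∈Sᵢ) = to (∈-⋃ᶠ (S ∘ suc)) a∈⋃ in noEdges (λ ()) a∈Sᵢ b∈S₀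

infix 4 _≤⁻_

data _≤⁻_ : ℕ⁻∞ → ℕ⁻∞ → Set where
  -∞≤_ : ∀ x → -∞ ≤⁻ x
  val≤ : ∀ {a b} → a ≤ b → val a ≤⁻ val b

≤⁻-refl : ∀ {x} → x ≤⁻ x
≤⁻-refl { -∞ }  = -∞≤ -∞
≤⁻-refl {val a} = val≤ ≤-refl

≤⁻-trans : ∀ {x y z} → x ≤⁻ y → y ≤⁻ z → x ≤⁻ z
≤⁻-trans (-∞≤ _)   _         = -∞≤ _
≤⁻-trans (val≤ a≤b) (val≤ b≤c) = val≤ (≤-trans a≤b b≤c)

≤⁻-antisym : ∀ {x y} → x ≤⁻ y → y ≤⁻ x → x ≡ y
≤⁻-antisym (-∞≤ _)    (-∞≤ _)    = refl
≤⁻-antisym (val≤ a≤b) (val≤ b≤a) = cong val (≤-antisym a≤b b≤a)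

≤⁻-preorder : Preorder _ _ _
≤⁻-preorder = record
  { Carrier    = ℕ⁻∞
  ; _≈_        = _≡_
  ; _≲_        = _≤⁻_
  ; isPreorder = record
    { isEquivalence = isEquivalence
    ; reflexive     = λ { refl → ≤⁻-refl }
    ; trans         = ≤⁻-trans
    }
  }

module ≤⁻-Reasoning = Relation.Binary.Reasoning.Preorder ≤⁻-preorder

x≤⁻x⊔y : ∀ x y → x ≤⁻ x ⊔⁻ y
x≤⁻x⊔y -∞      y       = -∞≤ y
x≤⁻x⊔y (val a) -∞      = ≤⁻-refl
x≤⁻x⊔y (val a) (val b) = val≤ (ℕ.m≤m⊔n a b)

y≤⁻x⊔y : ∀ x y → y ≤⁻ x ⊔⁻ y
y≤⁻x⊔y -∞      y       = ≤⁻-refl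
y≤⁻x⊔y (val a) -∞      = -∞≤ _
y≤⁻x⊔y (val a) (val b) = val≤ (ℕ.m≤n⊔m a b)

⊔⁻-lub : ∀ {x y z} → x ≤⁻ z → y ≤⁻ z → x ⊔⁻ y ≤⁻ z
⊔⁻-lub (-∞≤ _)    y≤z        = y≤z
⊔⁻-lub (val≤ a≤c) (-∞≤ _)    = val≤ a≤c
⊔⁻-lub (val≤ a≤c) (val≤ b≤c) = val≤ (ℕ.⊔-lub a≤c b≤c)

⊔⁻-sel : ∀ x y → x ⊔⁻ y ≡ x ⊎ x ⊔⁻ y ≡ y
⊔⁻-sel -∞      y       = inj₂ refl
⊔⁻-sel (val a) -∞      = inj₁ refl
⊔⁻-sel (val a) (val b) = Sum.map (cong val) (cong val) (ℕ.⊔-sel a b)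

+⁻-mono : ∀ {w x y z} → w ≤⁻ x → y ≤⁻ z → w +⁻ y ≤⁻ x +⁻ z
+⁻-mono (-∞≤ _)    _          = -∞≤ _
+⁻-mono (val≤ _)   (-∞≤ _)    = -∞≤ _
+⁻-mono (val≤ w≤x) (val≤ y≤z) = val≤ (ℕ.+-mono-≤ w≤x y≤z)

module _ {A : Set} (f : A → ℕ⁻∞) where

  maxOver-upper : ∀ {x xs} → x ∈ˡ xs → f x ≤⁻ maxOver xs f
  maxOver-upper {xs = y ∷ ys} (here refl)  = x≤⁻x⊔y (f y) (maxOver ys f)
  maxOver-upper {xs = y ∷ ys} (there x∈ys) = ≤⁻-trans (maxOver-upper x∈ys) (y≤⁻x⊔y (f y) (maxOver ys f))

  maxOver-least : ∀ xs {z} → (∀ {x} → x ∈ˡ xs → f x ≤⁻ z) → maxOver xs f ≤⁻ z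
  maxOver-least []       _     = -∞≤ _
  maxOver-least (y ∷ ys) upper = ⊔⁻-lub (upper (here refl)) (maxOver-least ys (upper ∘ there))

  maxOver-attained : ∀ xs {m} → maxOver xs f ≡ val m → ∃[ x ] x ∈ˡ xs × f x ≡ val m
  maxOver-attained (y ∷ ys) max≡m with ⊔⁻-sel (f y) (maxOver ys f)
  ... | inj₁ max≡fy   = y , here refl , trans (sym max≡fy) max≡m
  ... | inj₂ max≡rest = let (x , x∈ys , fx≡m) = maxOver-attained ys (trans (sym max≡rest) max≡m)
                        in x , there x∈ys , fx≡m

sum⁻-val : ∀ (g : Fin k → ℕ) → sum⁻ (val ∘ g) ≡ val (Vec.sum (tabulate g))
sum⁻-val {k = zero}  g = refl
sum⁻-val {k = suc k} g rewrite sum⁻-val (g ∘ suc) = refl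

sum⁻-cong : ∀ {f g : Fin k → ℕ⁻∞} → (∀ i → f i ≡ g i) → sum⁻ f ≡ sum⁻ g
sum⁻-cong f≗g = cong (Vec.foldr _ _+⁻_ (val 0)) (tabulate-cong f≗g)

sum⁻-mono : ∀ {f g : Fin k → ℕ⁻∞} → (∀ i → f i ≤⁻ g i) → sum⁻ f ≤⁻ sum⁻ g
sum⁻-mono {k = zero}  _   = ≤⁻-refl
sum⁻-mono {k = suc k} f≤g = +⁻-mono (f≤g zero) (sum⁻-mono (f≤g ∘ suc))

sum⁻-finite : ∀ (f : Fin k → ℕ⁻∞) → sum⁻ f ≡ -∞ ⊎ Σ[ g ∈ (Fin k → ℕ) ] (∀ i → f i ≡ val (g i))
sum⁻-finite {k = zero}  f = inj₂ ((λ ()) , λ ())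
sum⁻-finite {k = suc k} f with f zero in f₀≡ | sum⁻-finite (f ∘ suc)
... | -∞    | _                 = inj₁ refl
... | val a | inj₁ rest≡-∞      rewrite rest≡-∞ = inj₁ refl
... | val a | inj₂ (g , f∘suc≗val∘g) = inj₂ (a ∷ᶠ g , λ { zero → f₀≡ ; (suc i) → f∘suc≗val∘g i })

compositions-sound : ∀ k b {bs : Vec ℕ k} → bs ∈ˡ compositions k b → Vec.sum bs ≡ b
compositions-sound zero    zero (here refl) = refl
compositions-sound (suc k) b    bs∈
  with i , i∈upTo , bs∈map ← find (∈-concatMap⁻ (λ i → List.map (i ∷_) (compositions k (b ∸ i)))
                                                {xs = List.upTo (suc b)} bs∈)
  with bs′ , bs′∈ , refl ← ∈-map⁻ (i ∷_) bs∈map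
  = trans (cong (_+_ i) (compositions-sound k (b ∸ i) bs′∈)) (ℕ.m+[n∸m]≡n (ℕ.s≤s⁻¹ (∈-upTo⁻ i∈upTo)))

compositions-complete : ∀ k b {bs : Vec ℕ k} → Vec.sum bs ≡ b → bs ∈ˡ compositions k b
compositions-complete zero    zero {[]}     _      = here refl
compositions-complete (suc k) b    {i ∷ bs} sum≡b =
  ∈-concatMap⁺ (λ i → List.map (i ∷_) (compositions k (b ∸ i)))
    (lose (∈-upTo⁺ (ℕ.s≤s i≤b)) (∈-map⁺ (i ∷_) (compositions-complete k (b ∸ i) sum≡b∸i)))
  where
  i≤b : i ≤ b
  i≤b = subst (i ≤_) sum≡b (ℕ.m≤m+n i (Vec.sum bs))
  sum≡b∸i : Vec.sum bs ≡ b ∸ i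
  sum≡b∸i = trans (sym (ℕ.m+n∸m≡n i (Vec.sum bs))) (cong (_∸ i) sum≡b)

∈-𝒫-pred : ∀ b {bs : Vec ℕ k} → bs ∈ˡ 𝒫 k (+ b - + 1) ⇔ b ≡ suc (Vec.sum bs)
∈-𝒫-pred zero    = mk⇔ (λ ()) (λ ())
∈-𝒫-pred (suc b) = mk⇔ (cong suc ∘ sym ∘ compositions-sound _ b)
                       (compositions-complete _ b ∘ sym ∘ ℕ.suc-injective)

treeGraph-edge : ∀ (p : Fin n → Fin n) r x y → T (treeGraph p r x y) → p x ≡ y ⊎ p y ≡ x
treeGraph-edge p r x y edge =
  Sum.map (λ e → toWitness (proj₂ (to (T-∧ {not (x == r)}) e)))
          (λ e → toWitness (proj₂ (to (T-∧ {not (y == r)}) e)))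
          (to (T-∨ {not (x == r) ∧ (p x == y)}) edge)

module Descendants (p : Fin n → Fin n) where

  infix 4 _≼_

  _≼_ : Fin n → Fin n → Set
  v ≼ c = ∃[ j ] iter p j v ≡ c

  iter-+ : ∀ a b v → iter p (a + b) v ≡ iter p a (iter p b v)
  iter-+ zero    b v = refl
  iter-+ (suc a) b v = cong p (iter-+ a b v)

  iter-suc : ∀ j v → iter p (suc j) v ≡ iter p j (p v)
  iter-suc j v = trans (cong (λ m → iter p m v) (ℕ.+-comm 1 j)) (iter-+ j 1 v)

  ≼-above : ∀ {i j v a b} → i ≤ j → iter p i v ≡ a → iter p j v ≡ b → a ≼ b
  ≼-above {i} {j} {v} {a} {b} i≤j v→a v→b = j ∸ i , (begin
    iter p (j ∸ i) a              ≡⟨ cong (iter p (j ∸ i)) v→a ⟨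
    iter p (j ∸ i) (iter p i v)   ≡⟨ iter-+ (j ∸ i) i v ⟨
    iter p (j ∸ i + i) v          ≡⟨ cong (λ m → iter p m v) (ℕ.m∸n+n≡m i≤j) ⟩
    iter p j v                    ≡⟨ v→b ⟩
    b                             ∎)
    where open ≡-Reasoning

  ≼-linear : ∀ {v a b} → v ≼ a → v ≼ b → a ≼ b ⊎ b ≼ a
  ≼-linear (i , v→a) (j , v→b) with ℕ.≤-total i j
  ... | inj₁ i≤j = inj₁ (≼-above i≤j v→a v→b)
  ... | inj₂ j≤i = inj₂ (≼-above j≤i v→b v→a)

  -- By pigeonhole, some iterate among the first n + 1 repeats, so any path can be shortened below n.
  iter-short : ∀ j v → ∃[ i ] i < n × iter p i v ≡ iter p j v
  iter-short j v = go j (<-wellFounded j)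
    where
    go : ∀ j → Acc _<_ j → ∃[ i ] i < n × iter p i v ≡ iter p j v
    go j (acc shorter) with j ℕ.<? n
    ... | yes j<n = j , j<n , refl
    ... | no  j≮n =
      let a , b , a<b , same = pigeonhole (ℕ.n<1+n n) (λ (m : Fin (suc n)) → iter p (toℕ m) v)
          b≤j = ≤-trans (ℕ.s≤s⁻¹ (toℕ<n b)) (ℕ.≮⇒≥ j≮n)
          j′  = j ∸ toℕ b + toℕ a
          i , i<n , i→ = go j′ (shorter (subst (j′ <_) (ℕ.m∸n+n≡m b≤j) (ℕ.+-monoʳ-< (j ∸ toℕ b) a<b)))
      in i , i<n , (begin
        iter p i v                          ≡⟨ i→ ⟩
        iter p j′ v                         ≡⟨ iter-+ (j ∸ toℕ b) (toℕ a) v ⟩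
        iter p (j ∸ toℕ b) (iter p (toℕ a) v) ≡⟨ cong (iter p (j ∸ toℕ b)) same ⟩
        iter p (j ∸ toℕ b) (iter p (toℕ b) v) ≡⟨ iter-+ (j ∸ toℕ b) (toℕ b) v ⟨
        iter p (j ∸ toℕ b + toℕ b) v        ≡⟨ cong (λ m → iter p m v) (ℕ.m∸n+n≡m b≤j) ⟩
        iter p j v                          ∎)
      where open ≡-Reasoning

  ∈-subtree : ∀ {c v} → v ∈ subtree p c ⇔ v ≼ c
  ∈-subtree {c} {v} = mk⇔ ∈⇒≼ ≼⇒∈
    where
    reaches-c = λ w (j : Fin n) → iter p (toℕ j) w == c

    lookup-subtree : lookup (subtree p c) v ≡ any (reaches-c v) (allFin n)
    lookup-subtree = lookup∘tabulate (λ w → any (reaches-c w) (allFin n)) v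

    ∈⇒≼ : v ∈ subtree p c → v ≼ c
    ∈⇒≼ v∈ = let j , found = Any.satisfied (from (any⇔ {xs = allFin n} {p = reaches-c v})
                                                 (subst T lookup-subtree (from T-∈ᵇ v∈)))
             in toℕ j , toWitness found

    ≼⇒∈ : v ≼ c → v ∈ subtree p c
    ≼⇒∈ (j , v→c) = let i , i<n , i→ = iter-short j v in
      to T-∈ᵇ (subst T (sym lookup-subtree) (to any⇔ (lose (∈-allFin (fromℕ< i<n))
        (fromWitness (trans (cong (λ m → iter p m v) (toℕ-fromℕ< i<n)) (trans i→ v→c))))))

module RootedTree (p : Fin n → Fin n) (r : Fin n) (rooted : IsRootedTree p r) where

  open Descendants p public

  iter-root : ∀ j → iter p j r ≡ r
  iter-root zero    = refl
  iter-root (suc j) = trans (cong p (iter-root j)) (proj₁ rooted)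

  periodic⇒root : ∀ {d u} → iter p (suc d) u ≡ u → u ≡ r
  periodic⇒root {d} {u} period = begin
    u                           ≡⟨ periodic m ⟨
    iter p (m * suc d) u        ≡⟨ cong (λ e → iter p e u) (trans (ℕ.*-suc m d) (ℕ.+-comm m (m * d))) ⟩
    iter p (m * d + m) u        ≡⟨ iter-+ (m * d) m u ⟩
    iter p (m * d) (iter p m u) ≡⟨ cong (iter p (m * d)) u→r ⟩
    iter p (m * d) r            ≡⟨ iter-root (m * d) ⟩
    r                           ∎
    where
    open ≡-Reasoning
    m   = proj₁ (proj₂ rooted u)
    u→r = proj₂ (proj₂ rooted u)
    periodic : ∀ t → iter p (t * suc d) u ≡ u
    periodic zero    = refl
    periodic (suc t) = trans (iter-+ (suc d) (t * suc d) u) (trans (cong (iter p (suc d)) (periodic t)) period)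

  parent⋠child : ∀ {c u} → IsChild p r c u → ¬ (u ≼ c)
  parent⋠child (c≢r , pc≡u) (j , u→c) =
    c≢r (trans (sym u→c) (trans (cong (iter p j) (periodic⇒root {d = j} (trans (cong p u→c) pc≡u))) (iter-root j)))

  child⇒≼ : ∀ {c u v} → IsChild p r c u → v ≼ c → v ≼ u
  child⇒≼ (_ , pc≡u) (j , v→c) = suc j , trans (cong p v→c) pc≡u

  ≼-child : ∀ {u v} → v ≼ u → v ≢ u → ∃[ c ] IsChild p r c u × v ≼ c
  ≼-child {u} {v} (j , v→u) v≢u = go j v→u
    where
    go : ∀ j → iter p j v ≡ u → ∃[ c ] IsChild p r c u × v ≼ c
    go zero    v≡u = contradiction v≡u v≢u
    go (suc j) v→u with iter p j v ≟ᶠ u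
    ... | yes v→u′ = go j v→u′
    ... | no  c≢u  = iter p j v , (c≢r , v→u) , (j , refl)
      where
      c≢r : iter p j v ≢ r
      c≢r c≡r = c≢u (trans c≡r (trans (sym (proj₁ rooted)) (trans (cong p (sym c≡r)) v→u)))

  child≼child : ∀ {c₁ c₂ u} → IsChild p r c₁ u → IsChild p r c₂ u → c₁ ≼ c₂ → c₁ ≡ c₂
  child≼child _                 _      (zero  , c₁≡c₂) = c₁≡c₂
  child≼child {c₁} {c₂} {u} (_ , pc₁≡u) child₂ (suc j , c₁→c₂) = contradiction u≼c₂ (parent⋠child child₂)
    where
    u≼c₂ : u ≼ c₂
    u≼c₂ = j , trans (cong (iter p j) (sym pc₁≡u)) (trans (sym (iter-suc j c₁)) c₁→c₂)

  common-child : ∀ {c₁ c₂ u v} → IsChild p r c₁ u → IsChild p r c₂ u → v ≼ c₁ → v ≼ c₂ → c₁ ≡ c₂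
  common-child child₁ child₂ v≼c₁ v≼c₂ =
    [ child≼child child₁ child₂ , sym ∘ child≼child child₂ child₁ ]′ (≼-linear v≼c₁ v≼c₂)

  parent-across : ∀ {c₁ c₂ u x y} → IsChild p r c₁ u → IsChild p r c₂ u → c₁ ≢ c₂ →
                  x ≼ c₁ → y ≼ c₂ → p x ≢ y
  parent-across {c₂ = c₂} child₁ child₂ _ (zero , x≡c₁) y≼c₂ px≡y =
    parent⋠child child₂ (subst (_≼ c₂) (trans (sym px≡y) (trans (cong p x≡c₁) (proj₂ child₁))) y≼c₂)
  parent-across {x = x} {y} child₁ child₂ c₁≢c₂ (suc j , x→c₁) y≼c₂ px≡y =
    c₁≢c₂ (common-child child₁ child₂ (j , trans (cong (iter p j) (sym px≡y)) (trans (sym (iter-suc j x)) x→c₁)) y≼c₂)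

  NoEdges-children : ∀ {c₁ c₂ u} → IsChild p r c₁ u → IsChild p r c₂ u → c₁ ≢ c₂ →
                     NoEdges (treeGraph p r) (subtree p c₁) (subtree p c₂)
  NoEdges-children child₁ child₂ c₁≢c₂ x∈ y∈ edge =
    [ parent-across child₁ child₂ c₁≢c₂ (to ∈-subtree x∈) (to ∈-subtree y∈)
    , parent-across child₂ child₁ (c₁≢c₂ ∘ sym) (to ∈-subtree y∈) (to ∈-subtree x∈) ]′ (treeGraph-edge p r _ _ edge)

module _ (p : Fin n → Fin n) (r : Fin n) (τ : Fin n → Threshold) where

  private
    admissible : Bool → Fin n → ℕ → Subset n → Bool
    admissible inY w c Y = (Y ⊆ᵇ subtree p w) ∧ (∣ Y ∣ ≡ᵇ c) ∧ ⌊ Data.Bool._≟_ (w ∈ᵇ Y) inY ⌋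

    T-admissible : ∀ {inY w c Y} → T (admissible inY w c Y) ⇔ (Y ⊆ subtree p w × ∣ Y ∣ ≡ c × w ∈ᵇ Y ≡ inY)
    T-admissible {inY} {w} {c} {Y} = mk⇔ admissible⇒ admissible⇐
      where
      admissible⇒ : T (admissible inY w c Y) → Y ⊆ subtree p w × ∣ Y ∣ ≡ c × w ∈ᵇ Y ≡ inY
      admissible⇒ t = let (Y⊆ , t′) = to T-∧ t ; (size , root) = to T-∧ t′ in
                      to (T-⊆ᵇ Y (subtree p w)) Y⊆ , ≡ᵇ⇒≡ ∣ Y ∣ c size , toWitness root

      admissible⇐ : Y ⊆ subtree p w × ∣ Y ∣ ≡ c × w ∈ᵇ Y ≡ inY → T (admissible inY w c Y)
      admissible⇐ (Y⊆ , size , root) =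
        from T-∧ (from (T-⊆ᵇ Y (subtree p w)) Y⊆ , from T-∧ (≡⇒≡ᵇ ∣ Y ∣ c size , fromWitness root))

    candidate : Bool → Fin n → ℕ → Subset n → ℕ⁻∞
    candidate inY w c Y = if admissible inY w c Y then val (dyn (treeGraph p r) τ (subtree p w ─ Y)) else -∞

  yMax-upper : ∀ {inY w c Y} → Y ⊆ subtree p w → ∣ Y ∣ ≡ c → w ∈ᵇ Y ≡ inY →
               val (dyn (treeGraph p r) τ (subtree p w ─ Y)) ≤⁻ yMax p r τ inY w c
  yMax-upper {inY} {w} {c} {Y} Y⊆ size root =
    entry (from T-admissible (Y⊆ , size , root)) (maxOver-upper (candidate inY w c) (∈-allSubsets Y))
    where
    entry : T (admissible inY w c Y) → candidate inY w c Y ≤⁻ yMax p r τ inY w c →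
            val (dyn (treeGraph p r) τ (subtree p w ─ Y)) ≤⁻ yMax p r τ inY w c
    entry adm with admissible inY w c Y
    ... | true = λ upper → upper

  yMax-least : ∀ {inY w c z} →
               (∀ {Y} → Y ⊆ subtree p w → ∣ Y ∣ ≡ c → w ∈ᵇ Y ≡ inY →
                  val (dyn (treeGraph p r) τ (subtree p w ─ Y)) ≤⁻ z) →
               yMax p r τ inY w c ≤⁻ z
  yMax-least {inY} {w} {c} {z} bound = maxOver-least (candidate inY w c) (allSubsets n) λ {Y} _ → entry Y
    where
    entry : ∀ Y → candidate inY w c Y ≤⁻ z
    entry Y with admissible inY w c Y in adm
    ... | false = -∞≤ z
    ... | true  = let (Y⊆ , size , root) = to T-admissible (from T-≡ adm) in bound Y⊆ size root

  yMax-attained : ∀ {inY w c m} → yMax p r τ inY w c ≡ val m →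
                  ∃[ Y ] Y ⊆ subtree p w × ∣ Y ∣ ≡ c × dyn (treeGraph p r) τ (subtree p w ─ Y) ≡ m
  yMax-attained {inY} {w} {c} {m} max≡m =
    let Y , _ , entry≡m = maxOver-attained (candidate inY w c) (allSubsets n) max≡m in Y , entry Y entry≡m
    where
    entry : ∀ Y → candidate inY w c Y ≡ val m →
            Y ⊆ subtree p w × ∣ Y ∣ ≡ c × dyn (treeGraph p r) τ (subtree p w ─ Y) ≡ m
    entry Y entry≡m with admissible inY w c Y in adm | entry≡m
    ... | true | refl = let (Y⊆ , size , _) = to T-admissible (from T-≡ adm) in Y⊆ , size , refl

  dyn≤y∈⊔y₀ : ∀ {w c Y} → Y ⊆ subtree p w → ∣ Y ∣ ≡ c →
              val (dyn (treeGraph p r) τ (subtree p w ─ Y)) ≤⁻ y∈ p r τ w c ⊔⁻ y₀ p r τ w c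
  dyn≤y∈⊔y₀ {w} {c} {Y} Y⊆ size with w ∈ᵇ Y in root
  ... | true  = ≤⁻-trans (yMax-upper Y⊆ size root) (x≤⁻x⊔y _ _)
  ... | false = ≤⁻-trans (yMax-upper Y⊆ size root) (y≤⁻x⊔y _ _)

  y∈⊔y₀-attained : ∀ {w c m} → y∈ p r τ w c ⊔⁻ y₀ p r τ w c ≡ val m →
                   ∃[ Y ] Y ⊆ subtree p w × ∣ Y ∣ ≡ c × dyn (treeGraph p r) τ (subtree p w ─ Y) ≡ m
  y∈⊔y₀-attained {w} {c} max≡m with ⊔⁻-sel (y∈ p r τ w c) (y₀ p r τ w c)
  ... | inj₁ max≡y∈ = yMax-attained (trans (sym max≡y∈) max≡m)
  ... | inj₂ max≡y₀ = yMax-attained (trans (sym max≡y₀) max≡m)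

-- Splitting T_u at its root

module RootSplit (p : Fin n → Fin n) (r : Fin n) (rooted : IsRootedTree p r)
                 (u : Fin n) (vs : Vec (Fin n) k) (unique : Unique vs)
                 (children : ∀ v → (v ∈ᵛ vs → IsChild p r v u) × (IsChild p r v u → v ∈ᵛ vs)) where

  open RootedTree p r rooted

  G : Graph n
  G = treeGraph p r

  Tᵤ : Subset n
  Tᵤ = subtree p u

  Tᵥ : Fin k → Subset n
  Tᵥ i = subtree p (lookup vs i)

  child : ∀ i → IsChild p r (lookup vs i) u
  child i = proj₁ (children (lookup vs i)) (∈-lookup i vs)

  Tᵥ⊆Tᵤ : ∀ i → Tᵥ i ⊆ Tᵤ
  Tᵥ⊆Tᵤ i = from ∈-subtree ∘ child⇒≼ (child i) ∘ to ∈-subtree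

  u∉Tᵥ : ∀ i → u ∉ Tᵥ i
  u∉Tᵥ i = parent⋠child (child i) ∘ to ∈-subtree

  Tᵥ-cover : ∀ {v} → v ∈ Tᵤ → v ≢ u → ∃[ i ] v ∈ Tᵥ i
  Tᵥ-cover {v} v∈Tᵤ v≢u =
    let c , c-child , v≼c = ≼-child (to ∈-subtree v∈Tᵤ) v≢u
        c∈vs = proj₂ (children c) c-child
    in index c∈vs , from ∈-subtree (subst (v ≼_) (lookup-index c∈vs) v≼c)

  Tᵥ-disjoint : Pairwise Disjoint Tᵥ
  Tᵥ-disjoint i≢j v∈Tᵥᵢ v∈Tᵥⱼ =
    i≢j (lookup-injective unique _ _ (common-child (child _) (child _) (to ∈-subtree v∈Tᵥᵢ) (to ∈-subtree v∈Tᵥⱼ)))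

  Tᵥ-noEdges : Pairwise (NoEdges G) Tᵥ
  Tᵥ-noEdges i≢j = NoEdges-children (child _) (child _) (i≢j ∘ lookup-injective unique _ _)

  Tᵥ-index : ∀ {i j v} → v ∈ Tᵥ i → v ∈ Tᵥ j → i ≡ j
  Tᵥ-index {i} {j} v∈Tᵥᵢ v∈Tᵥⱼ with i ≟ᶠ j
  ... | yes i≡j = i≡j
  ... | no  i≢j = contradiction v∈Tᵥⱼ (Tᵥ-disjoint i≢j v∈Tᵥᵢ)

  assemble : (Fin k → Subset n) → Subset n
  assemble Ys = ⁅ u ⁆ ∪ ⋃ᶠ Ys

  assemble-restrict : ∀ {Y} → u ∈ Y → Y ⊆ Tᵤ → Y ≡ assemble (λ i → Y ∩ Tᵥ i)
  assemble-restrict {Y} u∈Y Y⊆Tᵤ = ⊆-antisym forward backward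
    where
    forward : Y ⊆ assemble (λ i → Y ∩ Tᵥ i)
    forward {x} x∈Y with x ≟ᶠ u
    ... | yes x≡u = x∈p∪q⁺ (inj₁ (subst (_∈ ⁅ u ⁆) (sym x≡u) (x∈⁅x⁆ u)))
    ... | no  x≢u = let i , x∈Tᵥᵢ = Tᵥ-cover (Y⊆Tᵤ x∈Y) x≢u in
                    x∈p∪q⁺ (inj₂ (from (∈-⋃ᶠ (λ i → Y ∩ Tᵥ i)) (i , x∈p∩q⁺ (x∈Y , x∈Tᵥᵢ))))
    backward : assemble (λ i → Y ∩ Tᵥ i) ⊆ Y
    backward x∈ with x∈p∪q⁻ ⁅ u ⁆ _ x∈
    ... | inj₁ x∈⁅u⁆ = subst (_∈ Y) (sym (x∈⁅y⁆⇒x≡y u x∈⁅u⁆)) u∈Y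
    ... | inj₂ x∈⋃   = let i , x∈Y∩Tᵥᵢ = to (∈-⋃ᶠ (λ i → Y ∩ Tᵥ i)) x∈⋃ in proj₁ (x∈p∩q⁻ Y (Tᵥ i) x∈Y∩Tᵥᵢ)

  module _ (Ys : Fin k → Subset n) (Ys⊆Tᵥ : ∀ i → Ys i ⊆ Tᵥ i) where

    u∈assemble : u ∈ assemble Ys
    u∈assemble = x∈p∪q⁺ (inj₁ (x∈⁅x⁆ u))

    assemble⊆Tᵤ : assemble Ys ⊆ Tᵤ
    assemble⊆Tᵤ x∈ with x∈p∪q⁻ ⁅ u ⁆ (⋃ᶠ Ys) x∈
    ... | inj₁ x∈⁅u⁆ = subst (_∈ Tᵤ) (sym (x∈⁅y⁆⇒x≡y u x∈⁅u⁆)) (from ∈-subtree (0 , refl))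
    ... | inj₂ x∈⋃   = let i , x∈Yᵢ = to (∈-⋃ᶠ Ys) x∈⋃ in Tᵥ⊆Tᵤ i (Ys⊆Tᵥ i x∈Yᵢ)

    ∣assemble∣ : ∣ assemble Ys ∣ ≡ suc (Vec.sum (tabulate (∣_∣ ∘ Ys)))
    ∣assemble∣ = trans (∣∪∣-disjoint ⁅ u ⁆ (⋃ᶠ Ys) ⁅u⁆∩⋃=∅) (cong₂ _+_ (∣⁅x⁆∣≡1 u) (∣⋃ᶠ∣ Ys Ys-disjoint))
      where
      Ys-disjoint : Pairwise Disjoint Ys
      Ys-disjoint i≢j x∈Yᵢ x∈Yⱼ = Tᵥ-disjoint i≢j (Ys⊆Tᵥ _ x∈Yᵢ) (Ys⊆Tᵥ _ x∈Yⱼ)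
      ⁅u⁆∩⋃=∅ : Disjoint ⁅ u ⁆ (⋃ᶠ Ys)
      ⁅u⁆∩⋃=∅ x∈⁅u⁆ x∈⋃ = let i , x∈Yᵢ = to (∈-⋃ᶠ Ys) x∈⋃ in
        u∉Tᵥ i (subst (_∈ Tᵥ i) (x∈⁅y⁆⇒x≡y u x∈⁅u⁆) (Ys⊆Tᵥ i x∈Yᵢ))

    Tᵤ─assemble : Tᵤ ─ assemble Ys ≡ ⋃ᶠ (λ i → Tᵥ i ─ Ys i)
    Tᵤ─assemble = ⊆-antisym forward backward
      where
      forward : Tᵤ ─ assemble Ys ⊆ ⋃ᶠ (λ i → Tᵥ i ─ Ys i)
      forward {x} x∈ =
        let x∉Y = x∈p─q⇒x∉q Tᵤ (assemble Ys) x∈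
            i , x∈Tᵥᵢ = Tᵥ-cover (p─q⊆p Tᵤ (assemble Ys) x∈)
                         (λ x≡u → x∉Y (x∈p∪q⁺ (inj₁ (subst (_∈ ⁅ u ⁆) (sym x≡u) (x∈⁅x⁆ u)))))
        in from (∈-⋃ᶠ (λ i → Tᵥ i ─ Ys i))
                (i , x∈p∧x∉q⇒x∈p─q x∈Tᵥᵢ (λ x∈Yᵢ → x∉Y (x∈p∪q⁺ (inj₂ (from (∈-⋃ᶠ Ys) (i , x∈Yᵢ))))))
      backward : ⋃ᶠ (λ i → Tᵥ i ─ Ys i) ⊆ Tᵤ ─ assemble Ys
      backward {x} x∈ = x∈p∧x∉q⇒x∈p─q (Tᵥ⊆Tᵤ i x∈Tᵥᵢ) x∉assemble
        where
        i = proj₁ (to (∈-⋃ᶠ (λ i → Tᵥ i ─ Ys i)) x∈)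
        x∈Tᵥᵢ = p─q⊆p (Tᵥ i) (Ys i) (proj₂ (to (∈-⋃ᶠ (λ i → Tᵥ i ─ Ys i)) x∈))
        x∉Yᵢ = x∈p─q⇒x∉q (Tᵥ i) (Ys i) (proj₂ (to (∈-⋃ᶠ (λ i → Tᵥ i ─ Ys i)) x∈))
        x∉assemble : x ∉ assemble Ys
        x∉assemble x∈Y with x∈p∪q⁻ ⁅ u ⁆ (⋃ᶠ Ys) x∈Y
        ... | inj₁ x∈⁅u⁆ = u∉Tᵥ i (subst (_∈ Tᵥ i) (x∈⁅y⁆⇒x≡y u x∈⁅u⁆) x∈Tᵥᵢ)
        ... | inj₂ x∈⋃   = let j , x∈Yⱼ = to (∈-⋃ᶠ Ys) x∈⋃ in
                           x∉Yᵢ (subst (λ l → x ∈ Ys l) (sym (Tᵥ-index x∈Tᵥᵢ (Ys⊆Tᵥ j x∈Yⱼ))) x∈Yⱼ)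

    dyn-assemble : ∀ τ → dyn G τ (Tᵤ ─ assemble Ys) ≡ Vec.sum (tabulate (λ i → dyn G τ (Tᵥ i ─ Ys i)))
    dyn-assemble τ = trans (cong (dyn G τ) Tᵤ─assemble) (dyn-⋃ᶠ G τ _ disjoint noEdges)
      where
      disjoint : Pairwise Disjoint (λ i → Tᵥ i ─ Ys i)
      disjoint i≢j x∈ y∈ = Tᵥ-disjoint i≢j (p─q⊆p _ _ x∈) (p─q⊆p _ _ y∈)
      noEdges : Pairwise (NoEdges G) (λ i → Tᵥ i ─ Ys i)
      noEdges i≢j a∈ b∈ = Tᵥ-noEdges i≢j (p─q⊆p _ _ a∈) (p─q⊆p _ _ b∈)

  module _ (τ : Fin n → Threshold) where

    y∈⊔y₀ : Fin n → ℕ → ℕ⁻∞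
    y∈⊔y₀ w c = y∈ p r τ w c ⊔⁻ y₀ p r τ w c

    childrenMax : ℕ → ℕ⁻∞
    childrenMax b = maxOver (𝒫 k (+ b - + 1)) (λ bs → sum⁻ (λ i → y∈⊔y₀ (lookup vs i) (lookup bs i)))

    y∈≤childrenMax : ∀ b → y∈ p r τ u b ≤⁻ childrenMax b
    y∈≤childrenMax b = yMax-least p r τ bound
      where
      bound : ∀ {Y} → Y ⊆ Tᵤ → ∣ Y ∣ ≡ b → u ∈ᵇ Y ≡ true → val (dyn G τ (Tᵤ ─ Y)) ≤⁻ childrenMax b
      bound {Y} Y⊆Tᵤ ∣Y∣≡b u∈ᵇY = begin
        val (dyn G τ (Tᵤ ─ Y))                                  ≡⟨ cong (λ Z → val (dyn G τ (Tᵤ ─ Z))) Y≡ ⟩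
        val (dyn G τ (Tᵤ ─ assemble Ys))                         ≡⟨ cong val (dyn-assemble Ys Ys⊆Tᵥ τ) ⟩
        val (Vec.sum (tabulate (λ i → dyn G τ (Tᵥ i ─ Ys i))))    ≡⟨ sum⁻-val (λ i → dyn G τ (Tᵥ i ─ Ys i)) ⟨
        sum⁻ (λ i → val (dyn G τ (Tᵥ i ─ Ys i)))                  ≲⟨ sum⁻-mono (λ i → dyn≤y∈⊔y₀ p r τ (Ys⊆Tᵥ i)
                                                                      (sym (lookup∘tabulate (∣_∣ ∘ Ys) i))) ⟩
        sum⁻ (λ i → y∈⊔y₀ (lookup vs i) (lookup bs i))           ≲⟨ maxOver-upper _ (from (∈-𝒫-pred b {bs}) b≡) ⟩
        childrenMax b                                            ∎
        where
        open ≤⁻-Reasoning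
        Ys : Fin k → Subset n
        Ys i = Y ∩ Tᵥ i
        Ys⊆Tᵥ : ∀ i → Ys i ⊆ Tᵥ i
        Ys⊆Tᵥ i = p∩q⊆q Y (Tᵥ i)
        bs : Vec ℕ k
        bs = tabulate (∣_∣ ∘ Ys)
        Y≡ : Y ≡ assemble Ys
        Y≡ = assemble-restrict (lookup⇒[]= u Y u∈ᵇY) Y⊆Tᵤ
        b≡ : b ≡ suc (Vec.sum bs)
        b≡ = trans (sym ∣Y∣≡b) (trans (cong ∣_∣ Y≡) (∣assemble∣ Ys Ys⊆Tᵥ))

    childrenMax≤y∈ : ∀ b → childrenMax b ≤⁻ y∈ p r τ u b
    childrenMax≤y∈ b = maxOver-least _ (𝒫 k (+ b - + 1)) λ {bs} bs∈ → bound bs (to (∈-𝒫-pred b) bs∈)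
      where
      bound : ∀ bs → b ≡ suc (Vec.sum bs) → sum⁻ (λ i → y∈⊔y₀ (lookup vs i) (lookup bs i)) ≤⁻ y∈ p r τ u b
      bound bs b≡ with sum⁻-finite (λ i → y∈⊔y₀ (lookup vs i) (lookup bs i))
      ... | inj₁ sum≡-∞    = subst (_≤⁻ y∈ p r τ u b) (sym sum≡-∞) (-∞≤ _)
      ... | inj₂ (g , y≡g) = begin
        sum⁻ (λ i → y∈⊔y₀ (lookup vs i) (lookup bs i))        ≡⟨ sum⁻-cong y≡g ⟩
        sum⁻ (val ∘ g)                                         ≡⟨ sum⁻-val g ⟩
        val (Vec.sum (tabulate g))                             ≡⟨ cong (val ∘ Vec.sum) (tabulate-cong dyn≡g) ⟨
        val (Vec.sum (tabulate (λ i → dyn G τ (Tᵥ i ─ Ys i))))  ≡⟨ cong val (dyn-assemble Ys Ys⊆Tᵥ τ) ⟨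
        val (dyn G τ (Tᵤ ─ assemble Ys))                       ≲⟨ yMax-upper p r τ (assemble⊆Tᵤ Ys Ys⊆Tᵥ) ∣Y∣≡b
                                                                    ([]=⇒lookup (u∈assemble Ys Ys⊆Tᵥ)) ⟩
        y∈ p r τ u b                                           ∎
        where
        open ≤⁻-Reasoning
        witness : ∀ i → ∃[ Y ] Y ⊆ Tᵥ i × ∣ Y ∣ ≡ lookup bs i × dyn G τ (Tᵥ i ─ Y) ≡ g i
        witness i = y∈⊔y₀-attained p r τ (y≡g i)
        Ys : Fin k → Subset n
        Ys i = proj₁ (witness i)
        Ys⊆Tᵥ : ∀ i → Ys i ⊆ Tᵥ i
        Ys⊆Tᵥ i = proj₁ (proj₂ (witness i))
        dyn≡g : ∀ i → dyn G τ (Tᵥ i ─ Ys i) ≡ g i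
        dyn≡g i = proj₂ (proj₂ (proj₂ (witness i)))
        size≡ : ∀ i → ∣ Ys i ∣ ≡ lookup bs i
        size≡ i = proj₁ (proj₂ (proj₂ (witness i)))
        ∣Y∣≡b : ∣ assemble Ys ∣ ≡ b
        ∣Y∣≡b = trans (∣assemble∣ Ys Ys⊆Tᵥ)
                      (trans (cong (suc ∘ Vec.sum) (trans (tabulate-cong size≡) (tabulate∘lookup bs))) (sym b≡))

lemma9 : ∀ {n : ℕ} (p : Fin n → Fin n) (r : Fin n) → IsRootedTree p r →
         (τ : Fin n → Threshold) (u : Fin n) (k : ℕ) (vs : Vec (Fin n) k) →
         k ≥ 1 → Unique vs → (∀ v → (v ∈ᵛ vs → IsChild p r v u) × (IsChild p r v u → v ∈ᵛ vs)) →
         (b : ℕ) →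
         y∈ p r τ u b
           ≡ maxOver (𝒫 k (+ b - + 1))
               (λ bs → sum⁻ (λ i → y∈ p r τ (lookup vs i) (lookup bs i)
                                    ⊔⁻ y₀ p r τ (lookup vs i) (lookup bs i)))
lemma9 p r rooted τ u k vs _ unique children b = ≤⁻-antisym (y∈≤childrenMax τ b) (childrenMax≤y∈ τ b)
  where open RootSplit p r rooted u vs unique children
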